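{- If $G$ is a finite simple graph with at least one edge, then $G$ has an optimal fractional PSD forcing set $(\mathcal{D},\mathcal{L})$ together with a forcing process starting from it whose first force is performed by a light blue vertex (a vertex of $\mathcal{L}$).
   Context: Three-color fractional PSD forcing game on $G$: each vertex is initially colored dark blue, light blue, or white; $\mathcal{D}$ is the set of dark blue and $\mathcal{L}$ the set of light blue vertices. At each step, with $\mathcal{D}_t,\mathcal{L}_t$ the current dark/light blue sets and $W_1,\dots,W_h$ the vertex sets of the connected components of $G-\mathcal{D}_t$: if $u\in\mathcal{D}_t\cup(\mathcal{L}_t\cap W_i)$ and $w\in W_i$ is the only neighbor of $u$ in $G[\mathcal{D}_t\cup W_i]$ that is light blue or white, then $u$ may force $w$, i.e. $w$ becomes dark blue. $(\mathcal{D},\mathcal{L})$ is a fractional PSD forcing set if repeated application can make all vertices dark blue. $\hat Z_f^+(G)$ is the minimum of $|\mathcal{D}|$ over fractional PSD forcing sets. A fractional PSD forcing set $(\mathcal{D},\mathcal{L})$ is optimal if $|\mathcal{D}|=\hat Z_f^+(G)$ and no fractional PSD forcing set with $\hat Z_f^+(G)$ dark blue vertices has fewer than $|\mathcal{L}|$ light blue vertices. -}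

module Defs where

open import Data.Nat using (ℕ; zero; suc; _≤_)
open import Data.Fin using (Fin; zero; suc; _≟_)
open import Data.Bool using (Bool; true; false)
open import Data.Product using (Σ; ∃; ∃-syntax; _×_; _,_)
open import Data.Sum using (_⊎_)
open import Relation.Binary.PropositionalEquality using (_≡_; _≢_)
open import Relation.Nullary using (¬_; yes; no)

record Graph (n : ℕ) : Set where
  field
    adj   : Fin n → Fin n → Bool
    sym   : ∀ i j → adj i j ≡ adj j i
    irrefl : ∀ i → adj i i ≡ false
open Graph public

Adj : ∀ {n} → Graph n → Fin n → Fin n → Set
Adj G i j = adj G i j ≡ true

HasEdge : ∀ {n} → Graph n → Set
HasEdge G = ∃[ i ] ∃[ j ] Adj G i j

data Color : Set where
  dark light white : Color

Coloring : ℕ → Set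
Coloring n = Fin n → Color

NonDark : ∀ {n} → Coloring n → Fin n → Set
NonDark c v = c v ≢ dark

-- x and y lie in the same connected component of G - D(c)
-- (both non-dark, joined by a path through non-dark vertices).
data SameComp {n} (G : Graph n) (c : Coloring n) : Fin n → Fin n → Set where
  here : ∀ {x} → NonDark c x → SameComp G c x x
  step : ∀ {x y z} → NonDark c x → Adj G x y → SameComp G c y z → SameComp G c x z

-- W = component of G - D(c) containing w.  The light/white vertices of
-- G[D(c) ∪ W] are exactly those of W, so the condition "w is the only light
-- blue or white neighbour of u in G[D(c) ∪ W]" reads: every neighbour v of u
-- lying in W equals w.
record Force {n} (G : Graph n) (c : Coloring n) (u w : Fin n) : Set where
  field
    w-nondark : NonDark c w
    u-ok      : c u ≡ dark ⊎ (c u ≡ light × SameComp G c u w)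
    u-adj-w   : Adj G u w
    unique    : ∀ v → Adj G u v → SameComp G c v w → v ≡ w

makeDark : ∀ {n} → Coloring n → Fin n → Coloring n
makeDark c w v with v ≟ w
... | yes _ = dark
... | no  _ = c v

AllDark : ∀ {n} → Coloring n → Set
AllDark c = ∀ v → c v ≡ dark

data FPSDForcing {n} (G : Graph n) : Coloring n → Set where
  done  : ∀ {c} → AllDark c → FPSDForcing G c
  force : ∀ {c} u w → Force G c u w → FPSDForcing G (makeDark c w) → FPSDForcing G c

count : ∀ {n} → (Fin n → Bool) → ℕ
count {zero}  p = 0
count {suc n} p with p zero
... | true  = suc (count (λ i → p (suc i)))
... | false = count (λ i → p (suc i))

isDark isLight : Color → Bool
isDark dark = true
isDark _    = false
isLight light = true
isLight _     = false

numDark numLight : ∀ {n} → Coloring n → ℕ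
numDark  c = count (λ v → isDark (c v))
numLight c = count (λ v → isLight (c v))

Optimal : ∀ {n} → Graph n → Coloring n → Set
Optimal G c =
  FPSDForcing G c
  × (∀ c' → FPSDForcing G c' → numDark c ≤ numDark c')
  × (∀ c' → FPSDForcing G c' → numDark c' ≡ numDark c → numLight c ≤ numLight c')

-- Take an optimal set c and a non-dark vertex v; one exists, since for an edge ij the colouring
-- in which only j is white is forcing.  Forces persist once available, so a forcing process can
-- be reordered, and the first force into the component W of v in G − D is already a legal force
-- of c.  If a light vertex performs it we are done.  If a dark vertex u forces w ∈ W, recolour u
-- white and w dark: w can force u back, so this is again a forcing set with as many dark
-- vertices.  Optimality excludes w light (one light vertex fewer) and w without non-dark
-- neighbours (then u white, w light is forcing: w forces u, u forces w, with one dark vertex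
-- fewer).  So w has a non-dark neighbour v′, whose component in the new optimal set lies in
-- W − w; induct on the size of that component.

module Submission where

open import Data.Bool using (Bool; true; false; not)
import Data.Bool.Properties as Bool
open import Data.Empty using (⊥-elim)
open import Data.Fin using (Fin; zero; suc; _≟_)
open import Data.Fin.Properties using (any?; all?; ¬∀⟶∃¬)
open import Data.List using (List; []; _∷_; filter; cartesianProductWith)
open import Data.List.Extrema.Nat using (argmin; argmin-all; f[argmin]≤f[xs])
open import Data.List.Membership.Propositional using (_∈_)
open import Data.List.Membership.Propositional.Properties using (∈-cartesianProductWith⁺; ∈-filter⁺)
open import Data.List.Relation.Unary.Any using (here; there)
import Data.List.Relation.Unary.All as All
open import Data.List.Relation.Unary.All.Properties using (all-filter)
open import Data.Nat using (ℕ; zero; suc; _≤_; _<_; z≤n; s≤s)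
import Data.Nat as ℕ
open import Data.Nat.Induction using (<-wellFounded)
open import Data.Nat.Properties using (≤-reflexive; <-≤-trans; <⇒≱; m≤n⇒m≤1+n)
open import Data.Product using (∃-syntax; _×_; _,_; proj₁; proj₂)
import Data.Product as Product
open import Data.Sum using (_⊎_; inj₁; inj₂; [_,_]′)
import Data.Sum as Sum
open import Data.Vec.Functional using (updateAt)
import Data.Vec.Functional as Vector
open import Data.Vec.Functional.Properties using (updateAt-updates; updateAt-minimal)
open import Function using (const; id; _∘_; _$_; case_of_)
open import Induction.WellFounded using (Acc; acc)
open import Relation.Binary.PropositionalEquality
open import Relation.Nullary using (Dec; does; yes; no; ¬_; ¬?)
open import Relation.Nullary.Decidable
  using (decidable-stable; dec-true; dec-false; map′; _×-dec_; _⊎-dec_; _→-dec_)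

open import Defs renaming (sym to adj-symmetric)

_≟ᶜ_ : (x y : Color) → Dec (x ≡ y)
dark  ≟ᶜ dark  = yes refl
dark  ≟ᶜ light = no λ ()
dark  ≟ᶜ white = no λ ()
light ≟ᶜ dark  = no λ ()
light ≟ᶜ light = yes refl
light ≟ᶜ white = no λ ()
white ≟ᶜ dark  = no λ ()
white ≟ᶜ light = no λ ()
white ≟ᶜ white = yes refl

light≢dark : light ≢ dark
light≢dark ()

white≢dark : white ≢ dark
white≢dark ()

isDark-false⁺ : ∀ {x} → x ≢ dark → isDark x ≡ false
isDark-false⁺ {dark}  x≢dark = ⊥-elim (x≢dark refl)
isDark-false⁺ {light} _      = refl
isDark-false⁺ {white} _      = refl

dec-true⁻ : ∀ {A : Set} (a? : Dec A) → does a? ≡ true → A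
dec-true⁻ (yes a) _ = a

count-cong : ∀ {n} {p q : Fin n → Bool} → p ≗ q → count p ≡ count q
count-cong {zero}  eq = refl
count-cong {suc n} {p} {q} eq with p zero | q zero | eq zero
... | true  | .true  | refl = cong suc (count-cong (λ i → eq (suc i)))
... | false | .false | refl = count-cong (λ i → eq (suc i))

count≤n : ∀ {n} (p : Fin n → Bool) → count p ≤ n
count≤n {zero}  p = z≤n
count≤n {suc n} p with p zero
... | true  = s≤s (count≤n (λ i → p (suc i)))
... | false = m≤n⇒m≤1+n (count≤n (λ i → p (suc i)))

count-mono-≤ : ∀ {n} {p q : Fin n → Bool} → (∀ i → p i ≡ true → q i ≡ true) →
               count p ≤ count q
count-mono-≤ {zero}  p⊆q = z≤n
count-mono-≤ {suc n} {p} {q} p⊆q with p zero in p0 | q zero in q0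
... | true  | true  = s≤s (count-mono-≤ (λ i → p⊆q (suc i)))
... | false | true  = m≤n⇒m≤1+n (count-mono-≤ (λ i → p⊆q (suc i)))
... | false | false = count-mono-≤ (λ i → p⊆q (suc i))
... | true  | false with () ← trans (sym (p⊆q zero p0)) q0

count-remove : ∀ {n} (p : Fin n → Bool) j → p j ≡ true →
               count p ≡ suc (count (updateAt p j (const false)))
count-remove p zero    pj rewrite pj = refl
count-remove p (suc j) pj with p zero
... | true  = cong suc (count-remove (λ i → p (suc i)) j pj)
... | false = count-remove (λ i → p (suc i)) j pj

count-exchange : ∀ {n} {p q : Fin n → Bool} j → p j ≡ true → q j ≡ false →
                 (∀ i → i ≢ j → p i ≡ q i) → count p ≡ suc (count q)
count-exchange {p = p} {q} j pj qj p≈q =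
  trans (count-remove p j pj) (cong suc (count-cong removed≗q))
  where
  removed≗q : updateAt p j (const false) ≗ q
  removed≗q i with i ≟ j
  ... | yes refl = trans (updateAt-updates i p) (sym qj)
  ... | no  i≢j  = trans (updateAt-minimal i j p i≢j) (p≈q i i≢j)

count-transpose : ∀ {n} {p q : Fin n → Bool} j k →
                  p j ≡ true → p k ≡ false → q j ≡ false → q k ≡ true →
                  (∀ i → i ≢ j → i ≢ k → p i ≡ q i) → count p ≡ count q
count-transpose {p = p} {q} j k pj pk qj qk p≈q =
  trans (count-remove p j pj) (sym (count-exchange k qk removed-k q≈removed))
  where
  k≢j : k ≢ j
  k≢j refl with () ← trans (sym pj) pk
  removed-k : updateAt p j (const false) k ≡ false
  removed-k = trans (updateAt-minimal k j p k≢j) pk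
  q≈removed : ∀ i → i ≢ k → q i ≡ updateAt p j (const false) i
  q≈removed i i≢k with i ≟ j
  ... | yes refl = trans qj (sym (updateAt-updates i p))
  ... | no  i≢j  = trans (sym (p≈q i i≢j i≢k)) (sym (updateAt-minimal i j p i≢j))

count-pos : ∀ {n} (p : Fin n → Bool) j → p j ≡ true → 0 < count p
count-pos p j pj rewrite count-remove p j pj = s≤s z≤n

count-mono-< : ∀ {n} {p q : Fin n → Bool} j → (∀ i → p i ≡ true → q i ≡ true) →
               p j ≡ false → q j ≡ true → count p < count q
count-mono-< {p = p} {q} j p⊆q pj qj rewrite count-remove q j qj = s≤s (count-mono-≤ p⊆removed)
  where
  p⊆removed : ∀ i → p i ≡ true → updateAt q j (const false) i ≡ true
  p⊆removed i pi with i ≟ j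
  ... | yes refl with () ← trans (sym pi) pj
  ... | no  i≢j  = trans (updateAt-minimal i j q i≢j) (p⊆q i pi)

makeDark-updates : ∀ {n} (c : Coloring n) w → makeDark c w w ≡ dark
makeDark-updates c w with w ≟ w
... | yes _   = refl
... | no  w≢w = ⊥-elim (w≢w refl)

makeDark-minimal : ∀ {n} (c : Coloring n) {w} v → v ≢ w → makeDark c w v ≡ c v
makeDark-minimal c {w} v v≢w with v ≟ w
... | yes v≡w = ⊥-elim (v≢w v≡w)
... | no  _   = refl

makeDark-cong : ∀ {n} {c c′ : Coloring n} w → c ≗ c′ → makeDark c w ≗ makeDark c′ w
makeDark-cong w c≗c′ v with v ≟ w
... | yes _ = refl
... | no  _ = c≗c′ v

makeDark-comm : ∀ {n} (c : Coloring n) a b → makeDark (makeDark c a) b ≗ makeDark (makeDark c b) a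
makeDark-comm c a b v = by-cases (v ≟ a) (v ≟ b)
  where
  open ≡-Reasoning
  by-cases : Dec (v ≡ a) → Dec (v ≡ b) → makeDark (makeDark c a) b v ≡ makeDark (makeDark c b) a v
  by-cases (yes refl) (yes refl) = refl
  by-cases (yes refl) (no v≢b) = begin
    makeDark (makeDark c v) b v  ≡⟨ makeDark-minimal (makeDark c v) v v≢b ⟩
    makeDark c v v               ≡⟨ makeDark-updates c v ⟩
    dark                         ≡⟨ makeDark-updates (makeDark c b) v ⟨
    makeDark (makeDark c b) v v  ∎
  by-cases (no v≢a) (yes refl) = begin
    makeDark (makeDark c a) v v  ≡⟨ makeDark-updates (makeDark c a) v ⟩
    dark                         ≡⟨ makeDark-updates c v ⟨
    makeDark c v v               ≡⟨ makeDark-minimal (makeDark c v) v v≢a ⟨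
    makeDark (makeDark c v) a v  ∎
  by-cases (no v≢a) (no v≢b) = begin
    makeDark (makeDark c a) b v  ≡⟨ makeDark-minimal (makeDark c a) v v≢b ⟩
    makeDark c a v               ≡⟨ makeDark-minimal c v v≢a ⟩
    c v                          ≡⟨ makeDark-minimal c v v≢b ⟨
    makeDark c b v               ≡⟨ makeDark-minimal (makeDark c b) v v≢a ⟨
    makeDark (makeDark c b) a v  ∎

recolor : ∀ {n} → Coloring n → Fin n → Color → Coloring n
recolor c v x = updateAt c v (const x)

makeDark-of-dark : ∀ {n} (c : Coloring n) {w} → c w ≡ dark → makeDark c w ≗ c
makeDark-of-dark c {w} w-dark v with v ≟ w
... | yes refl = sym w-dark
... | no  _    = refl

makeDark-preserves-dark : ∀ {n} (c : Coloring n) a {v} → c v ≡ dark → makeDark c a v ≡ dark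
makeDark-preserves-dark c a {v} cv≡dark with v ≟ a
... | yes _ = refl
... | no  _ = cv≡dark

NonDark-makeDark⁻ : ∀ {n} (c : Coloring n) a {v} → NonDark (makeDark c a) v → NonDark c v
NonDark-makeDark⁻ c a nd cv≡dark = nd (makeDark-preserves-dark c a cv≡dark)

isNonDark : Color → Bool
isNonDark x = not (isDark x)

isNonDark-true⁺ : ∀ {x} → x ≢ dark → isNonDark x ≡ true
isNonDark-true⁺ = cong not ∘ isDark-false⁺

isNonDark-true⁻ : ∀ {x} → isNonDark x ≡ true → x ≢ dark
isNonDark-true⁻ {dark} ()

numNonDark : ∀ {n} → Coloring n → ℕ
numNonDark c = count (λ v → isNonDark (c v))

numNonDark-pos : ∀ {n} (c : Coloring n) {a} → NonDark c a → 0 < numNonDark c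
numNonDark-pos c {a} nd = count-pos _ a (isNonDark-true⁺ nd)

numNonDark-makeDark : ∀ {n} (c : Coloring n) {a} → NonDark c a →
                      numNonDark (makeDark c a) < numNonDark c
numNonDark-makeDark c {a} nd = count-mono-< a
  (λ i nd′ → isNonDark-true⁺ (NonDark-makeDark⁻ c a (isNonDark-true⁻ nd′)))
  (cong isNonDark (makeDark-updates c a)) (isNonDark-true⁺ nd)

numNonDark-makeDark-≤ : ∀ {n} (c : Coloring n) {a k} → NonDark c a →
                        numNonDark c ≤ suc k → numNonDark (makeDark c a) ≤ k
numNonDark-makeDark-≤ c nd bound with s≤s le ← <-≤-trans (numNonDark-makeDark c nd) bound = le

numDark-cong : ∀ {n} {c c′ : Coloring n} → c ≗ c′ → numDark c ≡ numDark c′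
numDark-cong c≗c′ = count-cong (cong isDark ∘ c≗c′)

numLight-cong : ∀ {n} {c c′ : Coloring n} → c ≗ c′ → numLight c ≡ numLight c′
numLight-cong c≗c′ = count-cong (cong isLight ∘ c≗c′)

-- Enumerating colourings

∈-colors : ∀ x → x ∈ dark ∷ light ∷ white ∷ []
∈-colors dark  = here refl
∈-colors light = there (here refl)
∈-colors white = there (there (here refl))

allColorings : ∀ n → List (Coloring n)
allColorings zero    = Vector.[] ∷ []
allColorings (suc n) = cartesianProductWith Vector._∷_ (dark ∷ light ∷ white ∷ []) (allColorings n)

-- Colourings are functions, so the enumeration is complete only up to pointwise equality.
allColorings-complete : ∀ {n} (c : Coloring n) → ∃[ c′ ] (c′ ∈ allColorings n × c ≗ c′)
allColorings-complete {zero}  c = Vector.[] , here refl , λ ()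
allColorings-complete {suc n} c with c′ , c′∈ , c≗c′ ← allColorings-complete (Vector.tail c) =
  c zero Vector.∷ c′ , ∈-cartesianProductWith⁺ Vector._∷_ (∈-colors (c zero)) c′∈ , λ where
    zero    → refl
    (suc i) → c≗c′ i

module _ {n} {P : Coloring n → Set} (P? : ∀ c → Dec (P c))
         (P-cong : ∀ {c c′} → c ≗ c′ → P c → P c′)
         (f : Coloring n → ℕ) (f-cong : ∀ {c c′} → c ≗ c′ → f c ≡ f c′) where

  minimal-coloring : ∀ {a} → P a → ∃[ m ] (P m × ∀ c → P c → f m ≤ f c)
  minimal-coloring {a} Pa = m , argmin-all f Pa (all-filter P? (allColorings n)) , minimal
    where
    candidates : List (Coloring n)
    candidates = filter P? (allColorings n)
    m : Coloring n
    m = argmin f a candidates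
    minimal : ∀ c → P c → f m ≤ f c
    minimal c Pc with c′ , c′∈ , c≗c′ ← allColorings-complete c =
      subst (f m ≤_) (sym (f-cong c≗c′))
        (All.lookup (f[argmin]≤f[xs] a candidates) (∈-filter⁺ P? c′∈ (P-cong c≗c′ Pc)))

module _ {n : ℕ} (G : Graph n) where

  -- Components of G − D

  Adj-sym : ∀ {i j} → Adj G i j → Adj G j i
  Adj-sym {i} {j} i~j = trans (adj-symmetric G j i) i~j

  Adj-irrefl : ∀ {i j} → Adj G i j → i ≢ j
  Adj-irrefl {i} i~i refl with () ← trans (sym i~i) (irrefl G i)

  SameComp-nonDarkˡ : ∀ {c x z} → SameComp G c x z → NonDark c x
  SameComp-nonDarkˡ (here nd)     = nd
  SameComp-nonDarkˡ (step nd _ _) = nd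

  SameComp-nonDarkʳ : ∀ {c x z} → SameComp G c x z → NonDark c z
  SameComp-nonDarkʳ (here nd)    = nd
  SameComp-nonDarkʳ (step _ _ p) = SameComp-nonDarkʳ p

  SameComp-trans : ∀ {c x y z} → SameComp G c x y → SameComp G c y z → SameComp G c x z
  SameComp-trans (here _)       q = q
  SameComp-trans (step nd x~y p) q = step nd x~y (SameComp-trans p q)

  SameComp-snoc : ∀ {c x y z} → SameComp G c x y → Adj G y z → NonDark c z → SameComp G c x z
  SameComp-snoc p y~z nd = SameComp-trans p (step (SameComp-nonDarkʳ p) y~z (here nd))

  SameComp-sym : ∀ {c x z} → SameComp G c x z → SameComp G c z x
  SameComp-sym (here nd)       = here nd
  SameComp-sym (step nd x~y p) = SameComp-snoc (SameComp-sym p) (Adj-sym x~y) nd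

  SameComp-mono : ∀ {c c′ x z} → (∀ {a} → NonDark c′ a → NonDark c a) →
                  SameComp G c′ x z → SameComp G c x z
  SameComp-mono c′⊆c (here nd)       = here (c′⊆c nd)
  SameComp-mono c′⊆c (step nd x~y p) = step (c′⊆c nd) x~y (SameComp-mono c′⊆c p)

  NonDark-cong : ∀ {c c′ : Coloring n} → c ≗ c′ → ∀ {a} → NonDark c a → NonDark c′ a
  NonDark-cong c≗c′ {a} nd = nd ∘ trans (c≗c′ a)

  SameComp-cong : ∀ {c c′ x z} → c ≗ c′ → SameComp G c x z → SameComp G c′ x z
  SameComp-cong c≗c′ = SameComp-mono (NonDark-cong c≗c′)

  Adj? : ∀ i j → Dec (Adj G i j)
  Adj? i j = adj G i j Bool.≟ true

  SameComp-avoid : ∀ {c x b} a → SameComp G c x b → b ≢ a →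
                   SameComp G (makeDark c a) x b ⊎
                   ∃[ a′ ] (Adj G a a′ × SameComp G (makeDark c a) a′ b)
  SameComp-avoid {c} a (here nd) b≢a = inj₁ (here (nd ∘ trans (sym (makeDark-minimal c _ b≢a))))
  SameComp-avoid {c} a (step {x} nd x~y p) b≢a with SameComp-avoid a p b≢a | x ≟ a
  ... | inj₂ after-a | _        = inj₂ after-a
  ... | inj₁ avoids  | yes refl = inj₂ (_ , x~y , avoids)
  ... | inj₁ avoids  | no  x≢a  =
    inj₁ (step (nd ∘ trans (sym (makeDark-minimal c x x≢a))) x~y avoids)

  -- Recursion on the number of non-dark vertices: by SameComp-avoid, a path leaving a can be
  -- sought in makeDark c a.
  SameComp?-bounded : ∀ k c → numNonDark c ≤ k → ∀ a b → Dec (SameComp G c a b)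
  SameComp?-bounded k c bound a b with c a ≟ᶜ dark | a ≟ b
  ... | yes a-dark | _        = no λ p → SameComp-nonDarkˡ p a-dark
  ... | no  a-nd   | yes refl = yes (here a-nd)
  SameComp?-bounded zero c bound a b | no a-nd | no _
    with () ← <-≤-trans (numNonDark-pos c a-nd) bound
  SameComp?-bounded (suc k) c bound a b | no a-nd | no a≢b
    with any? (λ a′ → Adj? a a′ ×-dec
                      SameComp?-bounded k (makeDark c a) (numNonDark-makeDark-≤ c a-nd bound) a′ b)
  ... | yes (a′ , a~a′ , p) = yes (step a-nd a~a′ (SameComp-mono (NonDark-makeDark⁻ c a) p))
  ... | no  ∄a′ = no λ where
    (here _) → a≢b refl
    (step _ a~y p) →
      [ (λ avoids → ∄a′ (_ , a~y , avoids)) , ∄a′ ]′ (SameComp-avoid a p (a≢b ∘ sym))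

  SameComp? : ∀ c a b → Dec (SameComp G c a b)
  SameComp? c = SameComp?-bounded n c (count≤n _)

  ValidForcer : Coloring n → Fin n → Fin n → Set
  ValidForcer c u w = c u ≡ dark ⊎ (c u ≡ light × SameComp G c u w)

  light-ValidForcer : ∀ {c u w} → c u ≡ light → Adj G u w → NonDark c w → ValidForcer c u w
  light-ValidForcer u-light u~w w-nd =
    inj₂ (u-light , step (light≢dark ∘ trans (sym u-light)) u~w (here w-nd))

  Force-cong : ∀ {c c′ u w} → c ≗ c′ → Force G c u w → Force G c′ u w
  Force-cong {u = u} c≗c′ F = record
    { w-nondark = NonDark-cong c≗c′ (Force.w-nondark F)
    ; u-ok      = Sum.map (trans (sym (c≗c′ u)))
                          (Product.map (trans (sym (c≗c′ u))) (SameComp-cong c≗c′))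
                          (Force.u-ok F)
    ; u-adj-w   = Force.u-adj-w F
    ; unique    = λ v u~v p → Force.unique F v u~v (SameComp-cong (sym ∘ c≗c′) p)
    }

  FPSDForcing-cong : ∀ {c c′} → c ≗ c′ → FPSDForcing G c → FPSDForcing G c′
  FPSDForcing-cong c≗c′ (done all-dark)  = done λ v → trans (sym (c≗c′ v)) (all-dark v)
  FPSDForcing-cong c≗c′ (force u w F rest) =
    force u w (Force-cong c≗c′ F) (FPSDForcing-cong (makeDark-cong w c≗c′) rest)

  Force-persists : ∀ {c x y} z → z ≢ y → Force G c x y → Force G (makeDark c z) x y
  Force-persists {c} {x} {y} z z≢y F = record
    { w-nondark = y-nd
    ; u-ok      = forcer-ok (x ≟ z) (Force.u-ok F)
    ; u-adj-w   = Force.u-adj-w F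
    ; unique    = λ v x~v p → Force.unique F v x~v (SameComp-mono (NonDark-makeDark⁻ c z) p)
    }
    where
    y-nd : NonDark (makeDark c z) y
    y-nd = Force.w-nondark F ∘ trans (sym (makeDark-minimal c y (z≢y ∘ sym)))
    forcer-ok : Dec (x ≡ z) → ValidForcer c x y → ValidForcer (makeDark c z) x y
    forcer-ok (yes refl) _                = inj₁ (makeDark-updates c x)
    forcer-ok (no x≢z) (inj₁ x-dark)       = inj₁ (trans (makeDark-minimal c x x≢z) x-dark)
    forcer-ok (no x≢z) (inj₂ (x-light , _)) =
      light-ValidForcer (trans (makeDark-minimal c x x≢z) x-light) (Force.u-adj-w F) y-nd

  -- Since forces persist, any available force can be moved to the front of a forcing process.
  FPSDForcing-after-force : ∀ {c u w} → Force G c u w → FPSDForcing G c →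
                            FPSDForcing G (makeDark c w)
  FPSDForcing-after-force F (done all-dark) = ⊥-elim (Force.w-nondark F (all-dark _))
  FPSDForcing-after-force {c} {w = w} F (force x y F′ rest) with y ≟ w
  ... | yes refl = rest
  ... | no  y≢w  = force x y (Force-persists w (y≢w ∘ sym) F′)
    (FPSDForcing-cong (makeDark-comm c y w) (FPSDForcing-after-force (Force-persists y y≢w F) rest))

  Force? : ∀ c u w → Dec (Force G c u w)
  Force? c u w =
    map′ (λ (a , b , d , e) → record { w-nondark = a ; u-ok = b ; u-adj-w = d ; unique = e })
         (λ F → Force.w-nondark F , Force.u-ok F , Force.u-adj-w F , Force.unique F)
    (¬? (c w ≟ᶜ dark)
     ×-dec (c u ≟ᶜ dark ⊎-dec (c u ≟ᶜ light ×-dec SameComp? c u w))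
     ×-dec Adj? u w
     ×-dec all? (λ v → Adj? u v →-dec (SameComp? c v w →-dec v ≟ w)))

  FPSDForcing?-bounded : ∀ k c → numNonDark c ≤ k → Dec (FPSDForcing G c)
  FPSDForcing?-bounded k c bound
    with all? (λ v → c v ≟ᶜ dark) | any? (λ u → any? (λ w → Force? c u w))
  ... | yes all-dark | _ = yes (done all-dark)
  ... | no ¬all-dark | no ∄force = no λ where
    (done all-dark)   → ¬all-dark all-dark
    (force u w F _)   → ∄force (u , w , F)
  FPSDForcing?-bounded zero c bound | no _ | yes (u , w , F)
    with () ← <-≤-trans (numNonDark-pos c (Force.w-nondark F)) bound
  FPSDForcing?-bounded (suc k) c bound | no _ | yes (u , w , F)
    with FPSDForcing?-bounded k (makeDark c w) (numNonDark-makeDark-≤ c (Force.w-nondark F) bound)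
  ... | yes rest = yes (force u w F rest)
  ... | no ¬rest = no (¬rest ∘ FPSDForcing-after-force F)

  FPSDForcing? : ∀ c → Dec (FPSDForcing G c)
  FPSDForcing? c = FPSDForcing?-bounded n c (count≤n _)

  -- The first force into a component

  Darkening : Coloring n → Coloring n → Set
  Darkening c s = ∀ z → s z ≡ dark ⊎ s z ≡ c z

  Darkening-makeDark : ∀ {c s} y → Darkening c s → Darkening c (makeDark s y)
  Darkening-makeDark {c} {s} y c⊑s z = by-cases (z ≟ y)
    where
    by-cases : Dec (z ≡ y) → makeDark s y z ≡ dark ⊎ makeDark s y z ≡ c z
    by-cases (yes refl) = inj₁ (makeDark-updates s z)
    by-cases (no z≢y)   =
      Sum.map (trans (makeDark-minimal s z z≢y)) (trans (makeDark-minimal s z z≢y)) (c⊑s z)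

  Darkening-nonDark : ∀ {c s} → Darkening c s → ∀ {z} → NonDark s z → s z ≡ c z
  Darkening-nonDark c⊑s {z} nd = [ ⊥-elim ∘ nd , id ]′ (c⊑s z)

  -- While the component of v is untouched, the conditions for forcing into it are those of c.
  module _ {c s : Coloring n} {v : Fin n} (c⊑s : Darkening c s)
           (untouched : ∀ {z} → SameComp G c v z → NonDark s z) where

    SameComp-transport : ∀ {a b} → SameComp G c v a → SameComp G c a b → SameComp G s a b
    SameComp-transport v~a (here _)        = here (untouched v~a)
    SameComp-transport v~a (step _ a~y p) =
      step (untouched v~a) a~y (SameComp-transport (SameComp-snoc v~a a~y (SameComp-nonDarkˡ p)) p)

    Force-from-darkening : ∀ {x y} → SameComp G c v y → Force G s x y → Force G c x y
    Force-from-darkening {x} {y} v~y F = record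
      { w-nondark = SameComp-nonDarkʳ v~y
      ; u-ok      = forcer-ok (Force.u-ok F)
      ; u-adj-w   = Force.u-adj-w F
      ; unique    = λ v′ x~v′ p → Force.unique F v′ x~v′
                      (SameComp-transport (SameComp-trans v~y (SameComp-sym p)) p)
      }
      where
      forcer-ok : ValidForcer s x y → ValidForcer c x y
      forcer-ok (inj₁ sx-dark) with c x ≟ᶜ dark
      ... | yes cx-dark = inj₁ cx-dark
      ... | no  cx-nd   =
        ⊥-elim (untouched (SameComp-snoc v~y (Adj-sym (Force.u-adj-w F)) cx-nd) sx-dark)
      forcer-ok (inj₂ (sx-light , _)) =
        light-ValidForcer (trans (sym (Darkening-nonDark c⊑s (light≢dark ∘ trans (sym sx-light)))) sx-light)
          (Force.u-adj-w F) (SameComp-nonDarkʳ v~y)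

  first-force-into : ∀ {c s v} → Darkening c s → (∀ {z} → SameComp G c v z → NonDark s z) →
                     NonDark c v → FPSDForcing G s → ∃[ u ] ∃[ w ] (Force G c u w × SameComp G c v w)
  first-force-into {v = v} c⊑s untouched v-nd (done all-dark) =
    ⊥-elim (untouched (here v-nd) (all-dark v))
  first-force-into {c} {s} {v} c⊑s untouched v-nd (force x y F rest) with SameComp? c v y
  ... | yes v~y = x , y , Force-from-darkening c⊑s untouched v~y F , v~y
  ... | no  v≁y = first-force-into (Darkening-makeDark y c⊑s) untouched′ v-nd rest
    where
    untouched′ : ∀ {z} → SameComp G c v z → NonDark (makeDark s y) z
    untouched′ {z} v~z = untouched v~z ∘ trans (sym (makeDark-minimal s z λ { refl → v≁y v~z }))

  force-into-component : ∀ {c v} → FPSDForcing G c → NonDark c v →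
                         ∃[ u ] ∃[ w ] (Force G c u w × SameComp G c v w)
  force-into-component c-forcing v-nd =
    first-force-into (λ _ → inj₂ refl) SameComp-nonDarkʳ v-nd c-forcing

  -- Retreating a force by a dark vertex

  module Retreat {c : Coloring n} {u w : Fin n} (F : Force G c u w) (u-dark : c u ≡ dark) where

    u≢w : u ≢ w
    u≢w refl = Force.w-nondark F u-dark

    retreat : Color → Coloring n
    retreat x = recolor (recolor c u white) w x

    retreat-w : ∀ x → retreat x w ≡ x
    retreat-w x = updateAt-updates w (recolor c u white)

    retreat-u : ∀ x → retreat x u ≡ white
    retreat-u x = trans (updateAt-minimal u w (recolor c u white) u≢w) (updateAt-updates u c)

    retreat-other : ∀ x {z} → z ≢ u → z ≢ w → retreat x z ≡ c z
    retreat-other x {z} z≢u z≢w =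
      trans (updateAt-minimal z w (recolor c u white) z≢w) (updateAt-minimal z u c z≢u)

    retreat-cases : (P : Fin n → Set) → P u → P w → (∀ {z} → z ≢ u → z ≢ w → P z) →
                    ∀ z → P z
    retreat-cases P Pu Pw Pz z with z ≟ u | z ≟ w
    ... | yes refl | _        = Pu
    ... | no  _    | yes refl = Pw
    ... | no  z≢u  | no  z≢w  = Pz z≢u z≢w

    retreat-restored : ∀ x → makeDark (makeDark (retreat x) u) w ≗ makeDark c w
    retreat-restored x z = by-cases (z ≟ w) (z ≟ u)
      where
      open ≡-Reasoning
      by-cases : Dec (z ≡ w) → Dec (z ≡ u) → makeDark (makeDark (retreat x) u) w z ≡ makeDark c w z
      by-cases (yes refl) _ = trans (makeDark-updates _ z) (sym (makeDark-updates c z))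
      by-cases (no z≢w) (yes refl) = begin
        makeDark (makeDark (retreat x) z) w z  ≡⟨ makeDark-minimal _ z z≢w ⟩
        makeDark (retreat x) z z               ≡⟨ makeDark-updates (retreat x) z ⟩
        dark                                   ≡⟨ u-dark ⟨
        c z                                    ≡⟨ makeDark-minimal c z z≢w ⟨
        makeDark c w z                         ∎
      by-cases (no z≢w) (no z≢u) = begin
        makeDark (makeDark (retreat x) u) w z  ≡⟨ makeDark-minimal _ z z≢w ⟩
        makeDark (retreat x) u z               ≡⟨ makeDark-minimal (retreat x) z z≢u ⟩
        retreat x z                            ≡⟨ retreat-other x z≢u z≢w ⟩
        c z                                    ≡⟨ makeDark-minimal c z z≢w ⟨
        makeDark c w z                         ∎

    retreat-NonDark⁻ : ∀ x {z} → z ≢ u → z ≢ w → NonDark (retreat x) z → NonDark c z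
    retreat-NonDark⁻ x z≢u z≢w nd = nd ∘ trans (retreat-other x z≢u z≢w)

    retreat-component : ∀ {a b} → SameComp G c w a → a ≢ w → SameComp G (retreat dark) a b →
                        SameComp G c w b × b ≢ w
    retreat-component w~a a≢w (here _) = w~a , a≢w
    retreat-component {a} w~a a≢w (step {y = y} _ a~y p) with y ≟ u
    ... | yes refl = ⊥-elim (a≢w (Force.unique F a (Adj-sym a~y) (SameComp-sym w~a)))
    ... | no  y≢u  =
      retreat-component (SameComp-snoc w~a a~y (retreat-NonDark⁻ dark y≢u y≢w y-nd)) y≢w p
      where
      y-nd : NonDark (retreat dark) y
      y-nd = SameComp-nonDarkˡ p
      y≢w : y ≢ w
      y≢w refl = y-nd (retreat-w dark)

    retreat-dark-Force : Force G (retreat dark) w u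
    retreat-dark-Force = record
      { w-nondark = white≢dark ∘ trans (sym (retreat-u dark))
      ; u-ok      = inj₁ (retreat-w dark)
      ; u-adj-w   = Adj-sym (Force.u-adj-w F)
      ; unique    = unique
      }
      where
      unique : ∀ v → Adj G w v → SameComp G (retreat dark) v u → v ≡ u
      unique v w~v p with v ≟ u
      ... | yes v≡u = v≡u
      ... | no  v≢u = ⊥-elim (SameComp-nonDarkʳ (proj₁ (retreat-component w~v′ v≢w p)) u-dark)
        where
        v≢w : v ≢ w
        v≢w refl = SameComp-nonDarkˡ p (retreat-w dark)
        w~v′ : SameComp G c w v
        w~v′ = step (Force.w-nondark F) w~v
                 (here (retreat-NonDark⁻ dark v≢u v≢w (SameComp-nonDarkˡ p)))

    retreat-dark-forcing : FPSDForcing G c → FPSDForcing G (retreat dark)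
    retreat-dark-forcing c-forcing = force w u retreat-dark-Force
      (FPSDForcing-cong (λ z → trans (sym (retreat-restored dark z)) (makeDark-of-dark _ w-dark z))
        (FPSDForcing-after-force F c-forcing))
      where
      w-dark : makeDark (retreat dark) u w ≡ dark
      w-dark = makeDark-preserves-dark (retreat dark) u (retreat-w dark)

    module _ (w-isolated : ∀ {v} → Adj G w v → c v ≡ dark) where

      retreat-light-Force₁ : Force G (retreat light) w u
      retreat-light-Force₁ = record
        { w-nondark = white≢dark ∘ trans (sym (retreat-u light))
        ; u-ok      = light-ValidForcer (retreat-w light) (Adj-sym (Force.u-adj-w F))
                        (white≢dark ∘ trans (sym (retreat-u light)))
        ; u-adj-w   = Adj-sym (Force.u-adj-w F)
        ; unique    = unique
        }
        where
        unique : ∀ v → Adj G w v → SameComp G (retreat light) v u → v ≡ u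
        unique v w~v p with v ≟ u
        ... | yes v≡u = v≡u
        ... | no  v≢u = ⊥-elim (SameComp-nonDarkˡ p
                          (trans (retreat-other light v≢u (Adj-irrefl w~v ∘ sym)) (w-isolated w~v)))

      retreat-light-Force₂ : Force G (makeDark (retreat light) u) u w
      retreat-light-Force₂ = record
        { w-nondark = light≢dark ∘ trans (sym w-light)
        ; u-ok      = inj₁ (makeDark-updates (retreat light) u)
        ; u-adj-w   = Force.u-adj-w F
        ; unique    = λ v _ p → w-alone (SameComp-sym p)
        }
        where
        w-light : makeDark (retreat light) u w ≡ light
        w-light = trans (makeDark-minimal (retreat light) w (u≢w ∘ sym)) (retreat-w light)
        w-alone : ∀ {v} → SameComp G (makeDark (retreat light) u) w v → v ≡ w
        w-alone (here _) = refl
        w-alone (step {y = y} _ w~y p) with y ≟ u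
        ... | yes refl = ⊥-elim (SameComp-nonDarkˡ p (makeDark-updates (retreat light) y))
        ... | no  y≢u  = ⊥-elim (SameComp-nonDarkˡ p (begin
          makeDark (retreat light) u y  ≡⟨ makeDark-minimal (retreat light) y y≢u ⟩
          retreat light y               ≡⟨ retreat-other light y≢u (Adj-irrefl w~y ∘ sym) ⟩
          c y                           ≡⟨ w-isolated w~y ⟩
          dark                          ∎))
          where open ≡-Reasoning

      retreat-light-forcing : FPSDForcing G c → FPSDForcing G (retreat light)
      retreat-light-forcing c-forcing =
        force w u retreat-light-Force₁ (force u w retreat-light-Force₂
          (FPSDForcing-cong (sym ∘ retreat-restored light) (FPSDForcing-after-force F c-forcing)))

    retreat-light-numDark : numDark (retreat light) < numDark c
    retreat-light-numDark = count-mono-< u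
      (retreat-cases (λ z → isDark (retreat light z) ≡ true → isDark (c z) ≡ true)
        (λ _ → cong isDark u-dark)
        (λ w-dark → case trans (sym (cong isDark (retreat-w light))) w-dark of λ ())
        (λ z≢u z≢w → trans (cong isDark (sym (retreat-other light z≢u z≢w)))))
      (cong isDark (retreat-u light)) (cong isDark u-dark)

    retreat-dark-numDark : numDark (retreat dark) ≡ numDark c
    retreat-dark-numDark = sym (count-transpose u w
      (cong isDark u-dark) (isDark-false⁺ (Force.w-nondark F))
      (cong isDark (retreat-u dark)) (cong isDark (retreat-w dark))
      (λ _ z≢u z≢w → cong isDark (sym (retreat-other dark z≢u z≢w))))

    retreat-dark-numLight-white : c w ≡ white → numLight (retreat dark) ≡ numLight c
    retreat-dark-numLight-white w-white = count-cong
      (retreat-cases (λ z → isLight (retreat dark z) ≡ isLight (c z))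
        (trans (cong isLight (retreat-u dark)) (sym (cong isLight u-dark)))
        (trans (cong isLight (retreat-w dark)) (sym (cong isLight w-white)))
        (λ z≢u z≢w → cong isLight (retreat-other dark z≢u z≢w)))

    retreat-dark-numLight-light : c w ≡ light → numLight (retreat dark) < numLight c
    retreat-dark-numLight-light w-light = ≤-reflexive ∘ sym $
      count-exchange w (cong isLight w-light) (cong isLight (retreat-w dark))
      (retreat-cases (λ z → z ≢ w → isLight (c z) ≡ isLight (retreat dark z))
        (λ _ → trans (cong isLight u-dark) (sym (cong isLight (retreat-u dark))))
        (λ w≢w → ⊥-elim (w≢w refl))
        (λ z≢u z≢w _ → cong isLight (sym (retreat-other dark z≢u z≢w))))

  -- Optimal sets

  optimal-exists : ∃[ c ] Optimal G c
  optimal-exists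
    with d , d-forcing , d-minimal ←
           minimal-coloring FPSDForcing? FPSDForcing-cong numDark numDark-cong
             (done {c = const dark} λ _ → refl)
    with c , (c-forcing , c≡d) , c-minimal ←
           minimal-coloring (λ c → FPSDForcing? c ×-dec numDark c ℕ.≟ numDark d)
             (λ c≗c′ (f , e) → FPSDForcing-cong c≗c′ f , trans (sym (numDark-cong c≗c′)) e)
             numLight numLight-cong (d-forcing , refl)
    = c , c-forcing
        , (λ c′ f′ → subst (_≤ numDark c′) (sym c≡d) (d-minimal c′ f′))
        , (λ c′ f′ e → c-minimal c′ (f′ , trans e c≡d))

  Optimal-transfer : ∀ {c c′} → Optimal G c → FPSDForcing G c′ →
                     numDark c′ ≡ numDark c → numLight c′ ≡ numLight c → Optimal G c′
  Optimal-transfer (_ , dark-min , light-min) c′-forcing same-dark same-light =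
    c′-forcing ,
    (λ c″ f → subst (_≤ numDark c″) (sym same-dark) (dark-min c″ f)) ,
    (λ c″ f e → subst (_≤ numLight c″) (sym same-light) (light-min c″ f (trans e same-dark)))

  StrictSubcomponent : Coloring n → Fin n → Coloring n → Fin n → Set
  StrictSubcomponent c′ v′ c w = ∀ {b} → SameComp G c′ v′ b → SameComp G c w b × b ≢ w

  dark-force-retreats : ∀ {c u w} → Optimal G c → Force G c u w → c u ≡ dark →
    ∃[ c′ ] ∃[ v′ ] (Optimal G c′ × NonDark c′ v′ × StrictSubcomponent c′ v′ c w)
  dark-force-retreats {c} {u} {w} opt@(c-forcing , dark-min , light-min) F u-dark = by-color (c w) refl
    where
    open Retreat F u-dark
    by-color : ∀ x → c w ≡ x →
               ∃[ c′ ] ∃[ v′ ] (Optimal G c′ × NonDark c′ v′ × StrictSubcomponent c′ v′ c w)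
    by-color dark  w-dark  = ⊥-elim (Force.w-nondark F w-dark)
    by-color light w-light = ⊥-elim (<⇒≱ (retreat-dark-numLight-light w-light)
                               (light-min _ (retreat-dark-forcing c-forcing) retreat-dark-numDark))
    by-color white w-white with any? (λ v → Adj? w v ×-dec ¬? (c v ≟ᶜ dark))
    ... | no ∄v =
      ⊥-elim (<⇒≱ retreat-light-numDark (dark-min _ (retreat-light-forcing w-isolated c-forcing)))
      where
      w-isolated : ∀ {v} → Adj G w v → c v ≡ dark
      w-isolated {v} w~v = decidable-stable (c v ≟ᶜ dark) λ v-nd → ∄v (v , w~v , v-nd)
    ... | yes (v′ , w~v′ , v′-nd) =
      retreat dark , v′ ,
      Optimal-transfer opt (retreat-dark-forcing c-forcing)
        retreat-dark-numDark (retreat-dark-numLight-white w-white) ,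
      v′-nd ∘ trans (sym (retreat-other dark v′≢u v′≢w)) ,
      retreat-component (step (Force.w-nondark F) w~v′ (here v′-nd)) v′≢w
      where
      v′≢u : v′ ≢ u
      v′≢u refl = v′-nd u-dark
      v′≢w : v′ ≢ w
      v′≢w = Adj-irrefl w~v′ ∘ sym

  componentSize : Coloring n → Fin n → ℕ
  componentSize c v = count (λ b → does (SameComp? c v b))

  componentSize-< : ∀ {c v w c′ v′} → SameComp G c v w → StrictSubcomponent c′ v′ c w →
                    componentSize c′ v′ < componentSize c v
  componentSize-< {c} {v} {w} {c′} {v′} v~w sub = count-mono-< w
    (λ b v′~b → dec-true (SameComp? c v b)
                  (SameComp-trans v~w (proj₁ (sub (dec-true⁻ (SameComp? c′ v′ b) v′~b)))))
    (dec-false (SameComp? c′ v′ w) (λ v′~w → proj₂ (sub v′~w) refl))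
    (dec-true (SameComp? c v w) v~w)

  LightFirstForce : Coloring n → Set
  LightFirstForce c = ∃[ u ] ∃[ w ] (c u ≡ light × Force G c u w × FPSDForcing G (makeDark c w))

  light-first-force : ∀ {c v} → Optimal G c → NonDark c v → Acc _<_ (componentSize c v) →
                      ∃[ c′ ] (Optimal G c′ × LightFirstForce c′)
  light-first-force {c} opt v-nd (acc smaller) with force-into-component (proj₁ opt) v-nd
  ... | u , w , F , v~w with Force.u-ok F
  ...   | inj₂ (u-light , _) = c , opt , u , w , u-light , F , FPSDForcing-after-force F (proj₁ opt)
  ...   | inj₁ u-dark with c′ , v′ , opt′ , v′-nd , sub ← dark-force-retreats opt F u-dark =
    light-first-force opt′ v′-nd (smaller (componentSize-< v~w sub))

  optimal-not-all-dark : HasEdge G → ∀ {c} → Optimal G c → ¬ AllDark c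
  optimal-not-all-dark (i , j , i~j) {c} (_ , dark-min , _) all-dark =
    <⇒≱ fewer-dark (dark-min c′ c′-forcing)
    where
    c′ : Coloring n
    c′ = recolor (const dark) j white
    c′-other : ∀ {z} → z ≢ j → c′ z ≡ dark
    c′-other {z} z≢j = updateAt-minimal z j (const dark) z≢j
    all-dark′ : AllDark (makeDark c′ j)
    all-dark′ z with z ≟ j
    ... | yes _   = refl
    ... | no  z≢j = c′-other z≢j
    c′-forcing : FPSDForcing G c′
    c′-forcing = force i j
      (record
        { w-nondark = white≢dark ∘ trans (sym (updateAt-updates j (const dark)))
        ; u-ok      = inj₁ (c′-other (Adj-irrefl i~j))
        ; u-adj-w   = i~j
        ; unique    = λ v _ p → decidable-stable (v ≟ j) (SameComp-nonDarkˡ p ∘ c′-other)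
        })
      (done all-dark′)
    fewer-dark : numDark c′ < numDark c
    fewer-dark = count-mono-< j (λ z _ → cong isDark (all-dark z))
      (cong isDark (updateAt-updates j (const dark))) (cong isDark (all-dark j))

theorem2p28 : ∀ {n} (G : Graph n) → HasEdge G →
    ∃[ c ] (Optimal G c ×
            ∃[ u ] ∃[ w ] (c u ≡ light × Force G c u w × FPSDForcing G (makeDark c w)))
theorem2p28 G has-edge
  with c , opt ← optimal-exists G
  with v , v-nd ← ¬∀⟶∃¬ _ (λ v → c v ≡ dark) (λ v → c v ≟ᶜ dark)
                         (optimal-not-all-dark G has-edge opt)
  = light-first-force G opt v-nd (<-wellFounded _)
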